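{- Let $\mathbb F$ be a field of characteristic $0$ and let $b_1,\dots,b_m$ be linearly independent vectors in $\mathbb F^m$. Then there exists a polynomial mapping $f:\mathbb F\to\mathbb F^m$ of degree at most $m$ whose image contains the points $b_0=0,b_1,\dots,b_m$. In particular, $f$ is $(m-1,1)$-elusive.
   Context: A polynomial mapping $f:\mathbb F^n\to\mathbb F^m$ is $(s,r)$-elusive if for every polynomial mapping $\Gamma:\mathbb F^s\to\mathbb F^m$ whose components have degree at most $r$, one has $f(\mathbb F^n)\not\subset\Gamma(\mathbb F^s)$. -}

module Defs where

open import Level using (Level; _⊔_) renaming (suc to lsuc)
open import Data.Nat as ℕ using (ℕ; zero; suc)
open import Data.Fin using (Fin; zero; suc)
open import Data.List using (List; []; _∷_)
open import Data.Product using (Σ; ∃; _×_; _,_)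
open import Relation.Nullary using (¬_)
open import Algebra.Bundles using (CommutativeRing)

record Field (c ℓ : Level) : Set (lsuc (c ⊔ ℓ)) where
  field
    commutativeRing : CommutativeRing c ℓ
  open CommutativeRing commutativeRing public
  field
    0≉1     : ¬ (0# ≈ 1#)
    inverse : ∀ x → ¬ (x ≈ 0#) → ∃ λ y → (x * y) ≈ 1#

sumℕ : ∀ {n} → (Fin n → ℕ) → ℕ
sumℕ {zero}  f = zero
sumℕ {suc n} f = f zero ℕ.+ sumℕ (λ i → f (suc i))

totalDeg : ∀ {s} → (Fin s → ℕ) → ℕ
totalDeg e = sumℕ e

module _ {c ℓ : Level} (R : CommutativeRing c ℓ) where
  open CommutativeRing R using (Carrier; _≈_; _+_; _*_; 0#; 1#)

  fromℕ : ℕ → Carrier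
  fromℕ zero    = 0#
  fromℕ (suc n) = 1# + fromℕ n

  CharZero : Set ℓ
  CharZero = ∀ n → ¬ (fromℕ (suc n) ≈ 0#)

  pow : Carrier → ℕ → Carrier
  pow x zero    = 1#
  pow x (suc k) = x * pow x k

  sumF : ∀ {n} → (Fin n → Carrier) → Carrier
  sumF {zero}  f = 0#
  sumF {suc n} f = f zero + sumF (λ i → f (suc i))

  prodF : ∀ {n} → (Fin n → Carrier) → Carrier
  prodF {zero}  f = 1#
  prodF {suc n} f = f zero * prodF (λ i → f (suc i))

  Vecᶠ : ℕ → Set c
  Vecᶠ m = Fin m → Carrier

  _≈ᵛ_ : ∀ {m} → Vecᶠ m → Vecᶠ m → Set ℓ
  u ≈ᵛ v = ∀ j → u j ≈ v j

  0ᵛ : ∀ {m} → Vecᶠ m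
  0ᵛ j = 0#

  LinearlyIndependent : ∀ {k m} → (Fin k → Vecᶠ m) → Set (c ⊔ ℓ)
  LinearlyIndependent {k} {m} b =
    ∀ (a : Fin k → Carrier) →
      (λ j → sumF (λ i → a i * b i j)) ≈ᵛ 0ᵛ → ∀ i → a i ≈ 0#

  record Term (s r : ℕ) : Set c where
    constructor term
    field
      coeff  : Carrier
      exps   : Fin s → ℕ
      degOK  : totalDeg exps ℕ.≤ r

  Poly : ℕ → ℕ → Set c
  Poly s r = List (Term s r)

  evalTerm : ∀ {s r} → Term s r → Vecᶠ s → Carrier
  evalTerm t x = Term.coeff t * prodF (λ i → pow (x i) (Term.exps t i))

  evalPoly : ∀ {s r} → Poly s r → Vecᶠ s → Carrier
  evalPoly []       x = 0#
  evalPoly (t ∷ ts) x = evalTerm t x + evalPoly ts x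

  PolyMap : ℕ → ℕ → ℕ → Set c
  PolyMap n m r = Fin m → Poly n r

  evalMap : ∀ {n m r} → PolyMap n m r → Vecᶠ n → Vecᶠ m
  evalMap f x j = evalPoly (f j) x

  ImageSubset : ∀ {n m r s r'} → PolyMap n m r → PolyMap s m r' → Set (c ⊔ ℓ)
  ImageSubset {s = s} f Γ = ∀ x → ∃ λ (y : Vecᶠ s) → evalMap Γ y ≈ᵛ evalMap f x

  Elusive : ∀ {n m d} → PolyMap n m d → ℕ → ℕ → Set (c ⊔ ℓ)
  Elusive {n} {m} f s r = ∀ (Γ : PolyMap s m r) → ¬ ImageSubset f Γ

  InImage : ∀ {n m d} → PolyMap n m d → Vecᶠ m → Set (c ⊔ ℓ)
  InImage {n} f v = ∃ λ (x : Vecᶠ n) → evalMap f x ≈ᵛ v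

module Submission where

-- Idea: by Lagrange interpolation at the nodes 0, 1, …, m (distinct in
-- characteristic 0) there is a curve f of degree ≤ m through 0, b₁, …, bₘ.
-- If an affine Γ : F^(m-1) → F^m covered the image of f, then choosing
-- preimages y₀ of 0 and yᵢ of bᵢ, the linear part of Γ would send the m
-- vectors yᵢ - y₀ of F^(m-1) to the independent bᵢ, so those m vectors
-- would be independent in a space of dimension m - 1: impossible.

open import Defs
open import Level using (Level; _⊔_)
open import Data.Nat using (ℕ; zero; suc; _∸_; _≥_; _≤_; z≤n; s≤s)
open import Data.Nat.Properties using (≤-pred; m≤n⇒m≤1+n)
open import Data.Fin using (Fin; zero; suc; toℕ; punchIn; punchOut)
open import Data.Fin.Properties using (suc-injective; toℕ-injective; punchInᵢ≢i; punchIn-punchOut; _≟_)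
open import Data.Product using (Σ; ∃; _×_; _,_; proj₁; proj₂)
open import Data.Sum using (_⊎_; inj₁; inj₂)
open import Data.List using ([]; _∷_; _++_)
open import Function using (_∘_)
open import Relation.Nullary using (¬_; yes; no)
open import Relation.Binary.PropositionalEquality as ≡ using (_≢_)
open import Algebra.Bundles using (CommutativeRing)

module FiniteSums {c ℓ} (R : CommutativeRing c ℓ) where
  open CommutativeRing R hiding (zero)
  open import Algebra.Properties.Ring ring using (-0#≈0#; -‿+-comm)
  open import Algebra.Properties.CommutativeSemigroup +-commutativeSemigroup using (interchange)

  Σ-cong : ∀ {n} {f g : Fin n → Carrier} → (∀ i → f i ≈ g i) → sumF R f ≈ sumF R g
  Σ-cong {zero}  f≈g = refl
  Σ-cong {suc n} f≈g = +-cong (f≈g zero) (Σ-cong (f≈g ∘ suc))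

  Σ-zero : ∀ {n} {f : Fin n → Carrier} → (∀ i → f i ≈ 0#) → sumF R f ≈ 0#
  Σ-zero {zero}  f≈0 = refl
  Σ-zero {suc n} f≈0 = trans (+-cong (f≈0 zero) (Σ-zero (f≈0 ∘ suc))) (+-identityʳ 0#)

  Σ-+ : ∀ {n} (f g : Fin n → Carrier) → sumF R (λ i → f i + g i) ≈ sumF R f + sumF R g
  Σ-+ {zero}  f g = sym (+-identityʳ 0#)
  Σ-+ {suc n} f g = trans (+-cong refl (Σ-+ (f ∘ suc) (g ∘ suc))) (interchange _ _ _ _)

  Σ-neg : ∀ {n} (f : Fin n → Carrier) → sumF R (λ i → - f i) ≈ - sumF R f
  Σ-neg {zero}  f = sym -0#≈0#
  Σ-neg {suc n} f = trans (+-cong refl (Σ-neg (f ∘ suc))) (-‿+-comm _ _)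

  Σ-*ˡ : ∀ {n} (k : Carrier) (f : Fin n → Carrier) → k * sumF R f ≈ sumF R (λ i → k * f i)
  Σ-*ˡ {zero}  k f = zeroʳ k
  Σ-*ˡ {suc n} k f = trans (distribˡ k _ _) (+-cong refl (Σ-*ˡ k (f ∘ suc)))

  Σ-*ʳ : ∀ {n} (k : Carrier) (f : Fin n → Carrier) → sumF R f * k ≈ sumF R (λ i → f i * k)
  Σ-*ʳ {zero}  k f = zeroˡ k
  Σ-*ʳ {suc n} k f = trans (distribʳ k _ _) (+-cong refl (Σ-*ʳ k (f ∘ suc)))

  Σ-swap : ∀ {n k} (f : Fin n → Fin k → Carrier) →
           sumF R (λ i → sumF R (f i)) ≈ sumF R (λ j → sumF R (λ i → f i j))
  Σ-swap {zero}  {k} f = sym (Σ-zero {k} (λ j → refl))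
  Σ-swap {suc n}     f = trans (+-cong refl (Σ-swap (f ∘ suc)))
                               (sym (Σ-+ (f zero) (λ j → sumF R (λ i → f (suc i) j))))

  Σ-single : ∀ {n} (f : Fin n → Carrier) (p : Fin n) → (∀ i → i ≢ p → f i ≈ 0#) → sumF R f ≈ f p
  Σ-single f zero    off = trans (+-cong refl (Σ-zero (λ i → off (suc i) (λ ())))) (+-identityʳ _)
  Σ-single f (suc p) off =
    trans (+-cong (off zero (λ ())) (Σ-single (f ∘ suc) p (λ i i≢p → off (suc i) (i≢p ∘ suc-injective))))
          (+-identityˡ _)

module RingFacts {c ℓ} (R : CommutativeRing c ℓ) where
  open CommutativeRing R hiding (zero)
  open import Algebra.Properties.Ring ring using (-‿+-comm)
  open import Algebra.Properties.CommutativeSemigroup +-commutativeSemigroup using (interchange)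
  open import Relation.Binary.Reasoning.Setoid setoid

  cancel-+ : ∀ a x y → (a + x) - (a + y) ≈ x - y
  cancel-+ a x y = begin
    (a + x) + - (a + y)   ≈⟨ +-cong refl (sym (-‿+-comm a y)) ⟩
    (a + x) + (- a + - y) ≈⟨ interchange _ _ _ _ ⟩
    (a + - a) + (x + - y) ≈⟨ +-cong (-‿inverseʳ a) refl ⟩
    0# + (x + - y)        ≈⟨ +-identityˡ _ ⟩
    x - y                 ∎

  prod-zero : ∀ {n} (f : Fin n → Carrier) (p : Fin n) → f p ≈ 0# → prodF R f ≈ 0#
  prod-zero f zero    fp≈0 = trans (*-cong fp≈0 refl) (zeroˡ _)
  prod-zero f (suc p) fp≈0 = trans (*-cong refl (prod-zero (f ∘ suc) p fp≈0)) (zeroʳ _)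

module UnivariatePolynomials {c ℓ} (R : CommutativeRing c ℓ) where
  open CommutativeRing R hiding (zero)
  open import Algebra.Properties.CommutativeSemigroup *-commutativeSemigroup using (x∙yz≈y∙xz)
  open import Relation.Binary.Reasoning.Setoid setoid

  at : Carrier → Vecᶠ R 1
  at x _ = x

  ev : ∀ {r} → Poly R 1 r → Carrier → Carrier
  ev p x = evalPoly R p (at x)

  one : Poly R 1 0
  one = term 1# (λ _ → 0) z≤n ∷ []

  ev-one : ∀ x → ev one x ≈ 1#
  ev-one x = trans (+-identityʳ _) (trans (*-identityˡ _) (*-identityˡ _))

  mulLinear : ∀ {r} → Carrier → Poly R 1 r → Poly R 1 (suc r)
  mulLinear a []                   = []
  mulLinear a (term k e d ∷ ts) =
    term k (suc ∘ e) (s≤s d) ∷ term (- a * k) e (m≤n⇒m≤1+n d) ∷ mulLinear a ts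

  ev-mulLinear : ∀ {r} a (p : Poly R 1 r) x → ev (mulLinear a p) x ≈ (x - a) * ev p x
  ev-mulLinear a []                x = sym (zeroʳ _)
  ev-mulLinear a (term k e d ∷ ts) x = begin
      k * ((x * xᵉ) * 1#) + ((- a * k) * (xᵉ * 1#) + ev (mulLinear a ts) x)
        ≈⟨ +-cong (trans (*-cong refl (*-assoc x xᵉ 1#)) (x∙yz≈y∙xz k x (xᵉ * 1#)))
                  (+-cong (*-assoc (- a) k (xᵉ * 1#)) (ev-mulLinear a ts x)) ⟩
      x * t + (- a * t + (x - a) * rest) ≈⟨ sym (+-assoc _ _ _) ⟩
      (x * t + - a * t) + (x - a) * rest ≈⟨ +-cong (sym (distribʳ t x (- a))) refl ⟩
      (x - a) * t + (x - a) * rest      ≈⟨ sym (distribˡ _ _ _) ⟩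
      (x - a) * (t + rest)              ∎
    where
    xᵉ t rest : Carrier
    xᵉ   = pow R x (e zero)
    t    = k * (xᵉ * 1#)
    rest = ev ts x

  scale : ∀ {r} → Carrier → Poly R 1 r → Poly R 1 r
  scale k []                 = []
  scale k (term a e d ∷ ts) = term (k * a) e d ∷ scale k ts

  ev-scale : ∀ {r} k (p : Poly R 1 r) x → ev (scale k p) x ≈ k * ev p x
  ev-scale k []                x = sym (zeroʳ k)
  ev-scale k (term a e d ∷ ts) x =
    trans (+-cong (*-assoc _ _ _) (ev-scale k ts x)) (sym (distribˡ _ _ _))

  ev-++ : ∀ {r} (p q : Poly R 1 r) x → ev (p ++ q) x ≈ ev p x + ev q x
  ev-++ []      q x = sym (+-identityˡ _)
  ev-++ (t ∷ p) q x = trans (+-cong refl (ev-++ p q x)) (sym (+-assoc _ _ _))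

  sumPoly : ∀ {n r} → (Fin n → Poly R 1 r) → Poly R 1 r
  sumPoly {zero}  g = []
  sumPoly {suc n} g = g zero ++ sumPoly (g ∘ suc)

  ev-sumPoly : ∀ {n r} (g : Fin n → Poly R 1 r) x → ev (sumPoly g) x ≈ sumF R (λ i → ev (g i) x)
  ev-sumPoly {zero}  g x = refl
  ev-sumPoly {suc n} g x = trans (ev-++ (g zero) (sumPoly (g ∘ suc)) x) (+-cong refl (ev-sumPoly (g ∘ suc) x))

  productOfLinear : ∀ {k} → (Fin k → Carrier) → Poly R 1 k
  productOfLinear {zero}  a = one
  productOfLinear {suc k} a = mulLinear (a zero) (productOfLinear (a ∘ suc))

  ev-productOfLinear : ∀ {k} (a : Fin k → Carrier) x → ev (productOfLinear a) x ≈ prodF R (λ l → x - a l)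
  ev-productOfLinear {zero}  a x = ev-one x
  ev-productOfLinear {suc k} a x =
    trans (ev-mulLinear (a zero) (productOfLinear (a ∘ suc)) x) (*-cong refl (ev-productOfLinear (a ∘ suc) x))

module AffineMaps {c ℓ} (R : CommutativeRing c ℓ) where
  open CommutativeRing R hiding (zero)
  open FiniteSums R
  open RingFacts R using (cancel-+)
  open import Algebra.Properties.Ring ring using ([y-z]x≈yx-zx)
  open import Algebra.Properties.CommutativeSemigroup +-commutativeSemigroup using (interchange)
  open import Algebra.Properties.CommutativeSemigroup *-commutativeSemigroup using (x∙yz≈y∙xz)
  open import Relation.Binary.Reasoning.Setoid setoid

  linearPart : ∀ {s} → (Fin s → Carrier) → Vecᶠ R s → Carrier
  linearPart α y = sumF R (λ k → y k * α k)

  record AffineForm {s} (g : Vecᶠ R s → Carrier) : Set (c ⊔ ℓ) where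
    field
      constant : Carrier
      slope    : Fin s → Carrier
      formula  : ∀ y → g y ≈ constant + linearPart slope y
  open AffineForm

  linearPart-zero : ∀ {s} (y : Vecᶠ R s) → linearPart (λ _ → 0#) y ≈ 0#
  linearPart-zero y = Σ-zero (λ k → zeroʳ (y k))

  monomial : ∀ {s} → (Fin s → ℕ) → Vecᶠ R s → Carrier
  monomial e y = prodF R (λ i → pow R (y i) (e i))

  monomial-constant : ∀ {s} (e : Fin s → ℕ) → totalDeg e ≤ 0 → ∀ y → monomial e y ≈ 1#
  monomial-constant {zero}  e deg y = refl
  monomial-constant {suc s} e deg y with e zero
  ... | zero = trans (*-identityˡ _) (monomial-constant (e ∘ suc) deg (y ∘ suc))

  monomial-affine : ∀ {s} (e : Fin s → ℕ) → totalDeg e ≤ 1 → AffineForm (monomial e)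
  monomial-affine {zero}  e deg =
    record { constant = 1# ; slope = λ () ; formula = λ y → sym (+-identityʳ 1#) }
  monomial-affine {suc s} e deg with e zero
  ... | zero = record
    { constant = constant tail
    ; slope    = λ { zero → 0# ; (suc k) → slope tail k }
    ; formula  = λ y → trans (*-identityˡ _) (trans (formula tail (y ∘ suc))
                   (+-cong refl (sym (trans (+-cong (zeroʳ _) refl) (+-identityˡ _)))))
    }
    where
    tail : AffineForm (monomial (e ∘ suc))
    tail = monomial-affine (e ∘ suc) deg
  ... | suc zero = record
    { constant = 0#
    ; slope    = λ { zero → 1# ; (suc k) → 0# }
    ; formula  = λ y → begin
        y zero * 1# * monomial (e ∘ suc) (y ∘ suc)  ≈⟨ *-cong refl (monomial-constant (e ∘ suc) (≤-pred deg) (y ∘ suc)) ⟩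
        y zero * 1# * 1#                            ≈⟨ *-identityʳ _ ⟩
        y zero * 1#                                 ≈⟨ sym (+-identityʳ _) ⟩
        y zero * 1# + 0#                            ≈⟨ +-cong refl (sym (linearPart-zero (y ∘ suc))) ⟩
        y zero * 1# + linearPart (λ _ → 0#) (y ∘ suc) ≈⟨ sym (+-identityˡ _) ⟩
        0# + (y zero * 1# + linearPart (λ _ → 0#) (y ∘ suc)) ∎
    }
  monomial-affine {suc s} e (s≤s ()) | suc (suc _)

  term-affine : ∀ {s} (t : Term R s 1) → AffineForm (evalTerm R t)
  term-affine {s} (term k e deg) = record
    { constant = k * constant m
    ; slope    = λ i → k * slope m i
    ; formula  = λ y → trans (*-cong refl (formula m y)) (trans (distribˡ _ _ _)
                   (+-cong refl (trans (Σ-*ˡ k (λ i → y i * slope m i))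
                                       (Σ-cong {s} (λ i → x∙yz≈y∙xz k (y i) (slope m i))))))
    }
    where
    m : AffineForm (monomial e)
    m = monomial-affine e deg

  poly-affine : ∀ {s} (p : Poly R s 1) → AffineForm (evalPoly R p)
  poly-affine []          = record
    { constant = 0#
    ; slope    = λ _ → 0#
    ; formula  = λ y → sym (trans (+-cong refl (linearPart-zero y)) (+-identityʳ _))
    }
  poly-affine {s} (t ∷ p) = record
    { constant = constant g + constant h
    ; slope    = λ i → slope g i + slope h i
    ; formula  = λ y → trans (+-cong (formula g y) (formula h y)) (trans (interchange _ _ _ _)
                   (+-cong refl (trans (sym (Σ-+ (λ i → y i * slope g i) (λ i → y i * slope h i)))
                                       (Σ-cong {s} (λ i → sym (distribˡ (y i) _ _))))))
    }
    where
    g : AffineForm (evalTerm R t)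
    g = term-affine t
    h : AffineForm (evalPoly R p)
    h = poly-affine p

  affine-difference : ∀ {s} {g : Vecᶠ R s → Carrier} (a : AffineForm g) y y₀ →
                      g y - g y₀ ≈ sumF R (λ k → (y k - y₀ k) * slope a k)
  affine-difference {s} {g} a y y₀ = begin
    g y - g y₀                                         ≈⟨ +-cong (formula a y) (-‿cong (formula a y₀)) ⟩
    (κ + linearPart α y) - (κ + linearPart α y₀)       ≈⟨ cancel-+ _ _ _ ⟩
    linearPart α y - linearPart α y₀                   ≈⟨ +-cong refl (sym (Σ-neg (λ k → y₀ k * α k))) ⟩
    linearPart α y + sumF R (λ k → - (y₀ k * α k))     ≈⟨ sym (Σ-+ (λ k → y k * α k) (λ k → - (y₀ k * α k))) ⟩
    sumF R (λ k → y k * α k + - (y₀ k * α k))          ≈⟨ Σ-cong {s} (λ k → sym ([y-z]x≈yx-zx (α k) (y k) (y₀ k))) ⟩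
    sumF R (λ k → (y k - y₀ k) * α k)                  ∎
    where
    κ : Carrier
    κ = constant a
    α : Fin s → Carrier
    α = slope a

module FieldFacts {c ℓ} (F : Field c ℓ) where
  open Field F hiding (zero)
  open import Algebra.Properties.CommutativeSemigroup *-commutativeSemigroup using (xy∙z≈y∙xz)
  open import Relation.Binary.Reasoning.Setoid setoid

  cancel-nonzero : ∀ {x y} → x * y ≈ 0# → ¬ x ≈ 0# → y ≈ 0#
  cancel-nonzero {x} {y} xy≈0 x≉0 with inverse x x≉0
  ... | x⁻¹ , xx⁻¹≈1 = begin
      y              ≈⟨ sym (*-identityˡ y) ⟩
      1# * y         ≈⟨ *-cong (sym xx⁻¹≈1) refl ⟩
      (x * x⁻¹) * y  ≈⟨ xy∙z≈y∙xz x x⁻¹ y ⟩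
      x⁻¹ * (x * y)  ≈⟨ *-cong refl xy≈0 ⟩
      x⁻¹ * 0#       ≈⟨ zeroʳ x⁻¹ ⟩
      0#             ∎

  prod-nonzero : ∀ {n} (f : Fin n → Carrier) → (∀ i → ¬ f i ≈ 0#) → ¬ prodF commutativeRing f ≈ 0#
  prod-nonzero {zero}  f f≉0 1≈0 = 0≉1 (sym 1≈0)
  prod-nonzero {suc n} f f≉0 Π≈0 = prod-nonzero (f ∘ suc) (f≉0 ∘ suc) (cancel-nonzero Π≈0 (f≉0 zero))

module LinearDependence {c ℓ} (F : Field c ℓ) where
  open Field F hiding (zero)
  R : CommutativeRing c ℓ
  R = commutativeRing
  open FiniteSums R
  open import Algebra.Properties.Ring ring using (-‿distribˡ-*; -‿distribʳ-*)
  open import Relation.Binary.Reasoning.Setoid setoid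

  -- Equality in F is not decidable, but for the purpose of deriving a
  -- contradiction a vector is either zero or has a nonzero coordinate.
  zero-or-nonzeroCoordinate : ∀ {n} (x : Vecᶠ R n) → ¬ ¬ ((∀ j → x j ≈ 0#) ⊎ ∃ λ j → ¬ x j ≈ 0#)
  zero-or-nonzeroCoordinate {zero}  x k = k (inj₁ (λ ()))
  zero-or-nonzeroCoordinate {suc n} x k = zero-or-nonzeroCoordinate (x ∘ suc) λ
    { (inj₂ (j , xj≉0)) → k (inj₂ (suc j , xj≉0))
    ; (inj₁ tail≈0)     → k (inj₂ (zero , λ x₀≈0 → k (inj₁ λ { zero → x₀≈0 ; (suc j) → tail≈0 j })))
    }

  -- One step of Gaussian elimination: subtract multiples of the first
  -- vector z₀ from the others so that their pivot coordinate j vanishes,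
  -- then drop that coordinate.
  module Elimination {k n} (z : Fin (suc k) → Vecᶠ R (suc n)) (j : Fin (suc n)) (pivot≉0 : ¬ z zero j ≈ 0#) where
    pivot⁻¹ : Carrier
    pivot⁻¹ = proj₁ (inverse (z zero j) pivot≉0)

    factor : Fin k → Carrier
    factor i = z (suc i) j * pivot⁻¹

    reduced : Fin k → Vecᶠ R (suc n)
    reduced i x = z (suc i) x - factor i * z zero x

    reduced-pivot : ∀ i → reduced i j ≈ 0#
    reduced-pivot i = trans (+-cong refl (-‿cong factor·pivot)) (-‿inverseʳ _)
      where
      factor·pivot : factor i * z zero j ≈ z (suc i) j
      factor·pivot = trans (*-assoc _ _ _)
        (trans (*-cong refl (trans (*-comm _ _) (proj₂ (inverse (z zero j) pivot≉0)))) (*-identityʳ _))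

    eliminated : Fin k → Vecᶠ R n
    eliminated i x = reduced i (punchIn j x)

    -- Σᵢ aᵢ reducedᵢ is the combination of the z's with coefficients
    -- (- Σᵢ aᵢ factorᵢ, a₀, …, a_{k-1}).
    lift : (Fin k → Carrier) → Fin (suc k) → Carrier
    lift a zero    = - sumF R (λ i → a i * factor i)
    lift a (suc i) = a i

    lift-combination : ∀ a x → sumF R (λ i → a i * reduced i x) ≈ sumF R (λ κ → lift a κ * z κ x)
    lift-combination a x = begin
      sumF R (λ i → a i * reduced i x)
        ≈⟨ Σ-cong {k} (λ i → trans (distribˡ _ _ _) (+-cong refl (trans (sym (-‿distribʳ-* _ _))
             (trans (-‿cong (sym (*-assoc _ _ _))) (-‿distribˡ-* _ _))))) ⟩
      sumF R (λ i → a i * z (suc i) x + - (a i * factor i) * z zero x)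
        ≈⟨ Σ-+ (λ i → a i * z (suc i) x) (λ i → - (a i * factor i) * z zero x) ⟩
      sumF R (λ i → a i * z (suc i) x) + sumF R (λ i → - (a i * factor i) * z zero x)
        ≈⟨ +-cong refl (trans (sym (Σ-*ʳ (z zero x) (λ i → - (a i * factor i))))
                              (*-cong (Σ-neg (λ i → a i * factor i)) refl)) ⟩
      sumF R (λ i → a i * z (suc i) x) + lift a zero * z zero x
        ≈⟨ +-comm _ _ ⟩
      lift a zero * z zero x + sumF R (λ i → a i * z (suc i) x) ∎

    eliminated-independent : LinearlyIndependent R z → LinearlyIndependent R eliminated
    eliminated-independent z-indep a combination≈0 i = z-indep (lift a) lifted≈0 (suc i)
      where
      reduced-combination≈0 : ∀ x → sumF R (λ i → a i * reduced i x) ≈ 0#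
      reduced-combination≈0 x with j ≟ x
      ... | yes ≡.refl = Σ-zero {k} (λ i → trans (*-cong refl (reduced-pivot i)) (zeroʳ (a i)))
      ... | no j≢x     = ≡.subst (λ x′ → sumF R (λ i → a i * reduced i x′) ≈ 0#)
                                  (punchIn-punchOut j≢x) (combination≈0 (punchOut j≢x))
      lifted≈0 : ∀ x → sumF R (λ κ → lift a κ * z κ x) ≈ 0#
      lifted≈0 x = trans (sym (lift-combination a x)) (reduced-combination≈0 x)

  -- Induction on n: if z₀ = 0 the family is dependent, otherwise eliminate
  -- along a nonzero coordinate of z₀, leaving n vectors of F^(n-1).
  overfull-dependent : ∀ n (z : Fin (suc n) → Vecᶠ R n) → ¬ LinearlyIndependent R z
  overfull-dependent zero    z indep = 0≉1 (sym (indep (λ _ → 1#) (λ ()) zero))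
  overfull-dependent (suc n) z indep = zero-or-nonzeroCoordinate (z zero) λ
    { (inj₁ z₀≈0)        → 0≉1 (sym (indep unit₀ (unit₀-combination z₀≈0) zero))
    ; (inj₂ (j , z₀j≉0)) → overfull-dependent n (Elimination.eliminated z j z₀j≉0)
                             (Elimination.eliminated-independent z j z₀j≉0 indep)
    }
    where
    unit₀ : Fin (suc (suc n)) → Carrier
    unit₀ zero    = 1#
    unit₀ (suc _) = 0#
    unit₀-combination : (∀ j → z zero j ≈ 0#) → ∀ j → sumF R (λ i → unit₀ i * z i j) ≈ 0#
    unit₀-combination z₀≈0 j =
      trans (+-cong (trans (*-identityˡ _) (z₀≈0 j)) (Σ-zero {suc n} (λ i → zeroˡ (z (suc i) j))))
            (+-identityʳ 0#)

module Interpolation {c ℓ} (F : Field c ℓ) where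
  open Field F hiding (zero)
  R : CommutativeRing c ℓ
  R = commutativeRing
  open FiniteSums R
  open RingFacts R using (prod-zero)
  open FieldFacts F using (prod-nonzero)
  open UnivariatePolynomials R
  open import Relation.Binary.Reasoning.Setoid setoid

  Distinct : ∀ {m} → (Fin m → Carrier) → Set ℓ
  Distinct t = ∀ p q → p ≢ q → ¬ (t p - t q ≈ 0#)

  module _ {m} (t : Fin (suc m) → Carrier) (distinct : Distinct t) where
    others : Fin (suc m) → Fin m → Carrier
    others q l = t (punchIn q l)

    denominator : Fin (suc m) → Carrier
    denominator q = prodF R (λ l → t q - others q l)

    denominator-nonzero : ∀ q → ¬ denominator q ≈ 0#
    denominator-nonzero q =
      prod-nonzero _ (λ l → distinct q (punchIn q l) (λ q≡tₗ → punchInᵢ≢i q l (≡.sym q≡tₗ)))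

    denominator⁻¹ : Fin (suc m) → Carrier
    denominator⁻¹ q = proj₁ (inverse (denominator q) (denominator-nonzero q))

    lagrange : Fin (suc m) → Poly R 1 m
    lagrange q = scale (denominator⁻¹ q) (productOfLinear (others q))

    ev-lagrange : ∀ q x → ev (lagrange q) x ≈ denominator⁻¹ q * prodF R (λ l → x - others q l)
    ev-lagrange q x = trans (ev-scale (denominator⁻¹ q) (productOfLinear (others q)) x)
                            (*-cong refl (ev-productOfLinear (others q) x))

    lagrange-at-node : ∀ q → ev (lagrange q) (t q) ≈ 1#
    lagrange-at-node q = trans (ev-lagrange q (t q))
      (trans (*-comm _ _) (proj₂ (inverse (denominator q) (denominator-nonzero q))))

    lagrange-off-node : ∀ p q → p ≢ q → ev (lagrange q) (t p) ≈ 0#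
    lagrange-off-node p q p≢q = trans (ev-lagrange q (t p)) (trans (*-cong refl factor-vanishes) (zeroʳ _))
      where
      q≢p : q ≢ p
      q≢p = p≢q ∘ ≡.sym
      factor-vanishes : prodF R (λ l → t p - others q l) ≈ 0#
      factor-vanishes = prod-zero _ (punchOut q≢p)
        (trans (+-cong refl (-‿cong (reflexive (≡.cong t (punchIn-punchOut q≢p))))) (-‿inverseʳ _))

    interpolant : ∀ {k} → (Fin (suc m) → Vecᶠ R k) → PolyMap R 1 k m
    interpolant v j = sumPoly (λ q → scale (v q j) (lagrange q))

    interpolant-at-node : ∀ {k} (v : Fin (suc m) → Vecᶠ R k) p j → evalMap R (interpolant v) (at (t p)) j ≈ v p j
    interpolant-at-node v p j = begin
      ev (interpolant v j) (t p)
        ≈⟨ ev-sumPoly (λ q → scale (v q j) (lagrange q)) (t p) ⟩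
      sumF R (λ q → ev (scale (v q j) (lagrange q)) (t p))
        ≈⟨ Σ-cong {suc m} (λ q → ev-scale (v q j) (lagrange q) (t p)) ⟩
      sumF R (λ q → v q j * ev (lagrange q) (t p))
        ≈⟨ Σ-single (λ q → v q j * ev (lagrange q) (t p)) p off-node ⟩
      v p j * ev (lagrange p) (t p)
        ≈⟨ *-cong refl (lagrange-at-node p) ⟩
      v p j * 1#
        ≈⟨ *-identityʳ _ ⟩
      v p j ∎
      where
      off-node : ∀ q → q ≢ p → v q j * ev (lagrange q) (t p) ≈ 0#
      off-node q q≢p = trans (*-cong refl (lagrange-off-node p q (q≢p ∘ ≡.sym))) (zeroʳ _)

module CharacteristicZero {c ℓ} (R : CommutativeRing c ℓ) (char0 : CharZero R) where
  open CommutativeRing R hiding (zero)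
  open RingFacts R using (cancel-+)
  open import Algebra.Properties.Ring ring using (-0#≈0#; -‿involutive)
  open import Relation.Binary.Reasoning.Setoid setoid

  fromℕ-distinct : ∀ a b → a ≢ b → ¬ (fromℕ R a - fromℕ R b ≈ 0#)
  fromℕ-distinct zero    zero    a≢b _ = a≢b ≡.refl
  fromℕ-distinct (suc a) zero    a≢b d≈0 = char0 a (trans (sym (trans (+-cong refl -0#≈0#) (+-identityʳ _))) d≈0)
  fromℕ-distinct zero    (suc b) a≢b d≈0 = char0 b (begin
    fromℕ R (suc b)     ≈⟨ sym (-‿involutive _) ⟩
    - - fromℕ R (suc b) ≈⟨ -‿cong (trans (sym (+-identityˡ _)) d≈0) ⟩
    - 0#                ≈⟨ -0#≈0# ⟩
    0#                  ∎)
  fromℕ-distinct (suc a) (suc b) a≢b d≈0 =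
    fromℕ-distinct a b (a≢b ∘ ≡.cong suc) (trans (sym (cancel-+ 1# (fromℕ R a) (fromℕ R b))) d≈0)

  node : ∀ {m} → Fin m → Carrier
  node q = fromℕ R (toℕ q)

  nodes-distinct : ∀ {m} (p q : Fin m) → p ≢ q → ¬ (node p - node q ≈ 0#)
  nodes-distinct p q p≢q = fromℕ-distinct _ _ (p≢q ∘ toℕ-injective)

module Elusiveness {c ℓ} (F : Field c ℓ) where
  open Field F hiding (zero)
  R : CommutativeRing c ℓ
  R = commutativeRing
  open FiniteSums R
  open AffineMaps R using (poly-affine; affine-difference; module AffineForm)
  open LinearDependence F using (overfull-dependent)
  open import Algebra.Properties.Ring ring using (-0#≈0#)
  open import Relation.Binary.Reasoning.Setoid setoid

  independent-preimages : ∀ {k s m} (z : Fin k → Vecᶠ R s) (A : Fin m → Fin s → Carrier) (b : Fin k → Vecᶠ R m) →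
                          (∀ i j → b i j ≈ sumF R (λ r → z i r * A j r)) →
                          LinearlyIndependent R b → LinearlyIndependent R z
  independent-preimages {k} {s} z A b b≈Az b-indep a Σaz≈0 = b-indep a Σab≈0
    where
    Σab≈0 : ∀ j → sumF R (λ i → a i * b i j) ≈ 0#
    Σab≈0 j = begin
      sumF R (λ i → a i * b i j)
        ≈⟨ Σ-cong {k} (λ i → trans (*-cong refl (b≈Az i j)) (Σ-*ˡ (a i) (λ r → z i r * A j r))) ⟩
      sumF R (λ i → sumF R (λ r → a i * (z i r * A j r)))
        ≈⟨ Σ-swap (λ i r → a i * (z i r * A j r)) ⟩
      sumF R (λ r → sumF R (λ i → a i * (z i r * A j r)))
        ≈⟨ Σ-cong {s} (λ r → trans (Σ-cong {k} (λ i → sym (*-assoc (a i) (z i r) (A j r))))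
                                   (sym (Σ-*ʳ (A j r) (λ i → a i * z i r)))) ⟩
      sumF R (λ r → sumF R (λ i → a i * z i r) * A j r)
        ≈⟨ Σ-zero {s} (λ r → trans (*-cong (Σaz≈0 r) refl) (zeroˡ _)) ⟩
      0# ∎

  -- If the image of f contains 0 and m independent points of F^m, then f is
  -- (m-1,1)-elusive: preimages y₀, yᵢ under a covering affine Γ would give
  -- m independent vectors yᵢ - y₀ in F^(m-1).
  independentPoints⇒elusive : ∀ {n s d} (f : PolyMap R n (suc s) d) → InImage R f (0ᵛ R) →
                              (b : Fin (suc s) → Vecᶠ R (suc s)) → LinearlyIndependent R b →
                              (∀ i → InImage R f (b i)) → Elusive R f s 1
  independentPoints⇒elusive {s = s} f (x₀ , fx₀≈0) b b-indep b∈f Γ f⊆Γ =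
    overfull-dependent s (λ i r → y i r - y₀ r) (independent-preimages _ slope b b≈Δy b-indep)
    where
    y₀ : Vecᶠ R s
    y₀ = proj₁ (f⊆Γ x₀)
    Γy₀≈0 : ∀ j → evalMap R Γ y₀ j ≈ 0#
    Γy₀≈0 j = trans (proj₂ (f⊆Γ x₀) j) (fx₀≈0 j)
    y : Fin (suc s) → Vecᶠ R s
    y i = proj₁ (f⊆Γ (proj₁ (b∈f i)))
    Γy≈b : ∀ i j → evalMap R Γ (y i) j ≈ b i j
    Γy≈b i j = trans (proj₂ (f⊆Γ (proj₁ (b∈f i))) j) (proj₂ (b∈f i) j)
    slope : Fin (suc s) → Fin s → Carrier
    slope j = AffineForm.slope (poly-affine (Γ j))
    b≈Δy : ∀ i j → b i j ≈ sumF R (λ r → (y i r - y₀ r) * slope j r)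
    b≈Δy i j = begin
      b i j                                       ≈⟨ sym (trans (+-cong refl -0#≈0#) (+-identityʳ _)) ⟩
      b i j - 0#                                  ≈⟨ +-cong (sym (Γy≈b i j)) (-‿cong (sym (Γy₀≈0 j))) ⟩
      evalMap R Γ (y i) j - evalMap R Γ y₀ j      ≈⟨ affine-difference (poly-affine (Γ j)) (y i) y₀ ⟩
      sumF R (λ r → (y i r - y₀ r) * slope j r)   ∎

corollary3p7 : ∀ {c ℓ : Level} (F : Field c ℓ) → CharZero (Field.commutativeRing F) →
    ∀ (m : ℕ) → m ≥ 1 →
    ∀ (b : Fin m → Vecᶠ (Field.commutativeRing F) m) →
    LinearlyIndependent (Field.commutativeRing F) b →
    Σ (PolyMap (Field.commutativeRing F) 1 m m) λ f →
      (InImage (Field.commutativeRing F) f (0ᵛ (Field.commutativeRing F))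
        × (∀ (i : Fin m) → InImage (Field.commutativeRing F) f (b i)))
      × Elusive (Field.commutativeRing F) f (m ∸ 1) 1
corollary3p7 F char0 (suc n) _ b b-indep =
  curve , (through-0 , through-b) , Elusiveness.independentPoints⇒elusive F curve through-0 b b-indep through-b
  where
  R : CommutativeRing _ _
  R = Field.commutativeRing F
  open CharacteristicZero R char0 using (node; nodes-distinct)
  open Interpolation F using (interpolant; interpolant-at-node)
  open UnivariatePolynomials R using (at)

  targets : Fin (suc (suc n)) → Vecᶠ R (suc n)
  targets zero    = 0ᵛ R
  targets (suc i) = b i

  t : Fin (suc (suc n)) → CommutativeRing.Carrier R
  t = node

  curve : PolyMap R 1 (suc n) (suc n)
  curve = interpolant t nodes-distinct targets

  through-0 : InImage R curve (0ᵛ R)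
  through-0 = at (t zero) , interpolant-at-node t nodes-distinct targets zero

  through-b : ∀ i → InImage R curve (b i)
  through-b i = at (t (suc i)) , interpolant-at-node t nodes-distinct targets (suc i)
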